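{- Let $D=(F,T)\in\mathcal D_k$ and let $H,H'$ be graphs such that for all graphs $G\sqsubseteq_{\mathrm{col}} D$ with $(G,T[V(G)])\in\mathcal D_k$ it holds that $\mathrm{pi\text{ - }hom}((G,T[V(G)]),H)=\mathrm{pi\text{ - }hom}((G,T[V(G)]),H')$. Then $\hom(D,H)=\hom(D,H')$.
   Context: Graphs are finite, undirected, vertex-coloured triples $(V(G),E(G),\gamma^G)$. A homomorphism preserves edges and colours; $\hom$ counts homomorphisms. A tree is a finite poset $(V(T),\preceq)$ with a unique minimal element in which each $\{u:u\preceq t\}$ is a chain; height = maximum number of elements in a chain. For $U\subseteq V(T)$, $T[U]$ is the restriction of the order to $U$. An elimination tree of a graph $F$ is a tree on $V(F)$ with $u\preceq v$ or $v\preceq u$ for every edge $uv$. $\mathcal D_k$ is the class of pairs $(F,T)$ with $F$ a graph and $T$ an elimination tree of $F$ of height at most $k$ (so $(G,T[V(G)])\in\mathcal D_k$ requires $T[V(G)]$ to be a tree that is an elimination tree of $G$ of height at most $k$); $\hom(D,H):=\hom(F,H)$ for $D=(F,T)$. A homomorphism $g:(G,T')\to H$ is past-injective if $g(u)\ne g(v)$ whenever $u$ strictly precedes $v$ in $T'$; $\mathrm{pi\text{ - }hom}$ counts these. $G\sqsubseteq_{\mathrm{col}} D$ means $V(G)\subseteq V(F)$ and $\gamma^G=\gamma^F$ on $V(G)$. -}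

module Defs where

open import Data.Nat using (ℕ; zero; suc; _≤_; _≡ᵇ_)
open import Data.Bool using (Bool; true; false; _∧_; _∨_; not; if_then_else_)
open import Data.Fin using (Fin; zero; suc; _≟_)
open import Data.List using (List; []; _∷_; [_]; map; concatMap; allFin; length)
open import Data.List.Relation.Unary.AllPairs using (AllPairs)
open import Data.List.Relation.Unary.Unique.Propositional using (Unique)
open import Data.Product using (Σ; _×_)
open import Data.Sum using (_⊎_)
open import Relation.Binary.PropositionalEquality using (_≡_)
open import Relation.Nullary.Decidable using (⌊_⌋)

record Graph : Set where
  field
    size   : ℕ
    adj    : Fin size → Fin size → Bool
    sym    : ∀ u v → adj u v ≡ adj v u
    irrefl : ∀ v → adj v v ≡ false
    col    : Fin size → ℕ
open Graph public

-- A (candidate) order on Fin n, as a Boolean relation: le u v ≡ true means u ⪯ v.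
Rel : ℕ → Set
Rel n = Fin n → Fin n → Bool

Minimal : ∀ {n} → Rel n → Fin n → Set
Minimal le r = ∀ u → le u r ≡ true → u ≡ r

record IsTree {n : ℕ} (le : Rel n) : Set where
  field
    reflexive  : ∀ u → le u u ≡ true
    antisym    : ∀ u v → le u v ≡ true → le v u ≡ true → u ≡ v
    transitive : ∀ u v w → le u v ≡ true → le v w ≡ true → le u w ≡ true
    uniqueMin  : Σ (Fin n) λ r → Minimal le r × (∀ r' → Minimal le r' → r' ≡ r)
    downChain  : ∀ t u v → le u t ≡ true → le v t ≡ true →
                 (le u v ≡ true) ⊎ (le v u ≡ true)

Comparable : ∀ {n} → Rel n → Fin n → Fin n → Set
Comparable le u v = (le u v ≡ true) ⊎ (le v u ≡ true)

HeightAtMost : ∀ {n} → ℕ → Rel n → Set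
HeightAtMost {n} k le =
  (c : List (Fin n)) → Unique c → AllPairs (Comparable le) c → length c ≤ k

IsElimTree : (G : Graph) → Rel (size G) → Set
IsElimTree G le = ∀ u v → adj G u v ≡ true → Comparable le u v

InD : ℕ → (G : Graph) → Rel (size G) → Set
InD k G le = IsTree le × IsElimTree G le × HeightAtMost k le

-- restriction T[V(G)] of an order along the inclusion ι : V(G) ↪ V(F)
pull : ∀ {n m} → Rel n → (Fin m → Fin n) → Rel m
pull le ι a b = le (ι a) (ι b)

funs : (a b : ℕ) → List (Fin a → Fin b)
funs zero    b = [ (λ ()) ]
funs (suc a) b = concatMap (λ x → map (λ f → cons x f) (funs a b)) (allFin b)
  where
  cons : Fin b → (Fin a → Fin b) → Fin (suc a) → Fin b
  cons x f zero    = x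
  cons x f (suc i) = f i

countB : {A : Set} → (A → Bool) → List A → ℕ
countB p []       = 0
countB p (x ∷ xs) = if p x then suc (countB p xs) else countB p xs

allB : (n : ℕ) → (Fin n → Bool) → Bool
allB n p = allL (allFin n)
  where
  allL : List (Fin n) → Bool
  allL []       = true
  allL (x ∷ xs) = p x ∧ allL xs

isHom : (G H : Graph) → (Fin (size G) → Fin (size H)) → Bool
isHom G H f =
  allB (size G) (λ v → col H (f v) ≡ᵇ col G v) ∧
  allB (size G) (λ u → allB (size G) (λ v → not (adj G u v) ∨ adj H (f u) (f v)))

isPastInj : (G H : Graph) → Rel (size G) → (Fin (size G) → Fin (size H)) → Bool
isPastInj G H le f =
  allB (size G) (λ u → allB (size G) (λ v →
    not (le u v ∧ not ⌊ u ≟ v ⌋) ∨ not ⌊ f u ≟ f v ⌋))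

hom : Graph → Graph → ℕ
hom G H = countB (isHom G H) (funs (size G) (size H))

piHom : (G : Graph) → Rel (size G) → Graph → ℕ
piHom G le H = countB (λ f → isHom G H f ∧ isPastInj G H le f) (funs (size G) (size H))

-- Group the homomorphisms h : F → K by the map sending each vertex to its earliest ancestor in T
-- with the same image. Such a map r contracts F along T, and the homomorphisms inducing r
-- correspond exactly to the past-injective homomorphisms into K from the quotient F/r: a graph on
-- the fixed points of r, coloured as in F, on which T restricts to an elimination tree of height
-- at most k. Hence hom(F, K) is a sum of pi-hom counts of such quotients, which agree for H and H';
-- a map r induced by no homomorphism contributes nothing to either side.

module Submission where

open import Defs hiding (sym)
open import Algebra.Properties.CommutativeSemigroup using (interchange)
open import Data.Bool using (Bool; true; false; _∧_; _∨_; not)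
open import Data.Bool.ListAction using (all)
open import Data.Bool.Properties using (T-≡) renaming (_≟_ to _≟ᵇ_)
open import Data.Empty using (⊥-elim)
open import Data.Fin using (Fin; zero; suc; _≟_)
open import Data.Fin.Properties using (suc-injective; any?)
open import Data.List using (List; []; _∷_; map; concatMap; allFin; _++_)
open import Data.List.Membership.Propositional using (_∈_)
open import Data.List.Membership.Propositional.Properties using (∈-allFin)
open import Data.List.Properties using (map-cong; length-map)
import Data.List.Relation.Unary.All as All
open import Data.List.Relation.Unary.AllPairs using (_∷_)
import Data.List.Relation.Unary.AllPairs.Properties as AllPairs
open import Data.List.Relation.Unary.Any using (here; there)
open import Data.List.Relation.Unary.Unique.Propositional using (Unique)
import Data.List.Relation.Unary.Unique.Propositional.Properties as Unique
open import Data.Nat using (ℕ; zero; suc; _+_; _≤_; _≡ᵇ_)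
import Data.Nat as ℕ
open import Data.Nat.ListAction using (sum)
open import Data.Nat.Properties using (≡ᵇ⇒≡; ≡⇒≡ᵇ; +-assoc; +-commutativeSemigroup)
open import Data.Product using (Σ; ∃; ∃₂; _×_; _,_; proj₁; proj₂)
open import Data.Sum using (inj₁; inj₂)
open import Function using (_∘_; _⇔_; mk⇔; Equivalence)
open import Function.Definitions using (Injective)
open import Relation.Binary.PropositionalEquality
open import Relation.Nullary using (Dec; yes; no; ¬_)
open import Relation.Nullary.Decidable using (⌊_⌋; isYes≗does; dec-false; _×-dec_)

open Equivalence using (to; from)

private
  variable
    A B : Set

∧-true⁻ : ∀ {a b} → a ∧ b ≡ true → a ≡ true × b ≡ true
∧-true⁻ {true} b≡true = refl , b≡true

∧-true⁺ : ∀ {a b} → a ≡ true → b ≡ true → a ∧ b ≡ true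
∧-true⁺ refl refl = refl

≡true⇒≢false : ∀ {a} → a ≡ true → a ≢ false
≡true⇒≢false refl ()

≡true-ext : ∀ {a b} → (a ≡ true → b ≡ true) → (b ≡ true → a ≡ true) → a ≡ b
≡true-ext {true}           a⇒b _   = sym (a⇒b refl)
≡true-ext {false} {true}  _   b⇒a = b⇒a refl
≡true-ext {false} {false} _   _   = refl

not-∨-true⇔ : ∀ {a b} → not a ∨ b ≡ true ⇔ (a ≡ true → b ≡ true)
not-∨-true⇔ {true}  = mk⇔ (λ b≡true _ → b≡true) (λ imp → imp refl)
not-∨-true⇔ {false} = mk⇔ (λ _ ()) (λ _ → refl)

⌊⌋-true⇔ : ∀ {A : Set} (a? : Dec A) → ⌊ a? ⌋ ≡ true ⇔ A
⌊⌋-true⇔ (yes a) = mk⇔ (λ _ → a) (λ _ → refl)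
⌊⌋-true⇔ (no ¬a) = mk⇔ (λ ()) (λ a → ⊥-elim (¬a a))

⌊⌋-false : ∀ {A : Set} (a? : Dec A) → ¬ A → ⌊ a? ⌋ ≡ false
⌊⌋-false a? ¬a = trans (isYes≗does a?) (dec-false a? ¬a)

≡ᵇ-true⇔ : ∀ {m n} → (m ≡ᵇ n) ≡ true ⇔ m ≡ n
≡ᵇ-true⇔ {m} {n} = mk⇔
  (λ e → ≡ᵇ⇒≡ m n (T-≡ .from e))
  (λ e → T-≡ .to (≡⇒≡ᵇ m n e))

all-true⇔ : ∀ (p : A → Bool) xs → all p xs ≡ true ⇔ (∀ {x} → x ∈ xs → p x ≡ true)
all-true⇔ p [] = mk⇔ (λ _ ()) (λ _ → refl)
all-true⇔ p (x ∷ xs) = mk⇔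
  (λ e → let px , pxs = ∧-true⁻ e in λ where
    (here refl)  → px
    (there x∈xs) → all-true⇔ p xs .to pxs x∈xs)
  (λ h → ∧-true⁺ (h (here refl)) (all-true⇔ p xs .from (λ x∈xs → h (there x∈xs))))

-- allB folds over allFin n with a function local to its where-block, which cannot be named:
-- abstracting allFin n lets unification pick it as the g of all-unique.
all-unique : ∀ (p : A → Bool) (g : List A → Bool) → g [] ≡ true →
  (∀ x xs → g (x ∷ xs) ≡ p x ∧ g xs) → ∀ xs → g xs ≡ all p xs
all-unique p g g[] g∷ [] = g[]
all-unique p g g[] g∷ (x ∷ xs) = trans (g∷ x xs) (cong (p x ∧_) (all-unique p g g[] g∷ xs))

allB≡all : ∀ n (p : Fin n → Bool) → allB n p ≡ all p (allFin n)
allB≡all n p with allFin n | all-unique p _ refl (λ _ _ → refl)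
... | xs | allL≡all = allL≡all xs

allB-true⇔ : ∀ {n} {p : Fin n → Bool} → allB n p ≡ true ⇔ (∀ x → p x ≡ true)
allB-true⇔ {n} {p} = mk⇔
  (λ e x → all-true⇔ p (allFin n) .to (trans (sym (allB≡all n p)) e) (∈-allFin x))
  (λ h → trans (allB≡all n p) (all-true⇔ p (allFin n) .from (λ {x} _ → h x)))

-- Homomorphisms and past-injective maps

record IsHom (G H : Graph) (f : Fin (size G) → Fin (size H)) : Set where
  constructor isHomomorphism
  field
    col-pres : ∀ v → col H (f v) ≡ col G v
    adj-pres : ∀ u v → adj G u v ≡ true → adj H (f u) (f v) ≡ true

PastInjective : (G H : Graph) → Rel (size G) → (Fin (size G) → Fin (size H)) → Set
PastInjective G H le f = ∀ u v → le u v ≡ true → u ≢ v → f u ≢ f v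

isHom⇔ : ∀ G H f → isHom G H f ≡ true ⇔ IsHom G H f
isHom⇔ G H f = mk⇔
  (λ e → let c , a = ∧-true⁻ e in isHomomorphism
    (λ v → ≡ᵇ-true⇔ .to (allB-true⇔ .to c v))
    (λ u v → not-∨-true⇔ .to (allB-true⇔ .to (allB-true⇔ .to a u) v)))
  (λ (isHomomorphism c a) → ∧-true⁺
    (allB-true⇔ .from (λ v → ≡ᵇ-true⇔ .from (c v)))
    (allB-true⇔ .from (λ u → allB-true⇔ .from (λ v → not-∨-true⇔ .from (a u v)))))

past-inj-clause⇔ : ∀ {m n} {u v : Fin m} {x y : Fin n} {a} →
  not (a ∧ not ⌊ u ≟ v ⌋) ∨ not ⌊ x ≟ y ⌋ ≡ true ⇔ (a ≡ true → u ≢ v → x ≢ y)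
past-inj-clause⇔ {u = u} {v} {x} {y} {a} with a | u ≟ v | x ≟ y
... | false | _     | _     = mk⇔ (λ _ ()) (λ _ → refl)
... | true  | yes p | _     = mk⇔ (λ _ _ u≢v → ⊥-elim (u≢v p)) (λ _ → refl)
... | true  | no _  | no q  = mk⇔ (λ _ _ _ → q) (λ _ → refl)
... | true  | no p  | yes q = mk⇔ (λ ()) (λ h → ⊥-elim (h refl p q))

isPastInj⇔ : ∀ G H le f → isPastInj G H le f ≡ true ⇔ PastInjective G H le f
isPastInj⇔ G H le f = mk⇔
  (λ e u v → past-inj-clause⇔ .to (allB-true⇔ .to (allB-true⇔ .to e u) v))
  (λ h → allB-true⇔ .from (λ u → allB-true⇔ .from (λ v → past-inj-clause⇔ .from (h u v))))

module _ (G H : Graph) {f g : Fin (size G) → Fin (size H)} (f≗g : f ≗ g) where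

  IsHom-≗ : IsHom G H f → IsHom G H g
  IsHom-≗ (isHomomorphism c a) = isHomomorphism
    (λ v → trans (cong (col H) (sym (f≗g v))) (c v))
    (λ u v uv → subst₂ (λ x y → adj H x y ≡ true) (f≗g u) (f≗g v) (a u v uv))

  PastInjective-≗ : ∀ {le} → PastInjective G H le f → PastInjective G H le g
  PastInjective-≗ h u v uv u≢v gu≡gv = h u v uv u≢v (trans (f≗g u) (trans gu≡gv (sym (f≗g v))))

isHom-≗ : ∀ G H {f g : Fin (size G) → Fin (size H)} → f ≗ g → isHom G H f ≡ isHom G H g
isHom-≗ G H {f} {g} f≗g = ≡true-ext
  (λ e → isHom⇔ G H g .from (IsHom-≗ G H f≗g (isHom⇔ G H f .to e)))
  (λ e → isHom⇔ G H f .from (IsHom-≗ G H (λ x → sym (f≗g x)) (isHom⇔ G H g .to e)))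

isPastInj-≗ : ∀ G H le {f g : Fin (size G) → Fin (size H)} → f ≗ g →
  isPastInj G H le f ≡ isPastInj G H le g
isPastInj-≗ G H le {f} {g} f≗g = ≡true-ext
  (λ e → isPastInj⇔ G H le g .from (PastInjective-≗ G H f≗g (isPastInj⇔ G H le f .to e)))
  (λ e → isPastInj⇔ G H le f .from
    (PastInjective-≗ G H (λ x → sym (f≗g x)) (isPastInj⇔ G H le g .to e)))

-- Counting

indicator : Bool → ℕ
indicator true  = 1
indicator false = 0

countB-∷ : ∀ (p : A → Bool) x xs → countB p (x ∷ xs) ≡ indicator (p x) + countB p xs
countB-∷ p x xs with p x
... | true  = refl
... | false = refl

countB-cong : ∀ {p q : A → Bool} → (∀ x → p x ≡ q x) → ∀ xs → countB p xs ≡ countB q xs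
countB-cong p≗q []       = refl
countB-cong {p = p} {q} p≗q (x ∷ xs) = begin
  countB p (x ∷ xs)              ≡⟨ countB-∷ p x xs ⟩
  indicator (p x) + countB p xs  ≡⟨ cong₂ _+_ (cong indicator (p≗q x)) (countB-cong p≗q xs) ⟩
  indicator (q x) + countB q xs  ≡⟨ countB-∷ q x xs ⟨
  countB q (x ∷ xs)              ∎
  where open ≡-Reasoning

countB-none : ∀ {p : A → Bool} xs → (∀ {x} → x ∈ xs → p x ≡ false) → countB p xs ≡ 0
countB-none []       _    = refl
countB-none {p = p} (x ∷ xs) none =
  trans (countB-∷ p x xs)
        (cong₂ _+_ (cong indicator (none (here refl))) (countB-none xs (none ∘ there)))

countB≢0⇒∃ : ∀ (p : A → Bool) xs → countB p xs ≢ 0 → ∃ λ x → p x ≡ true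
countB≢0⇒∃ p []       ≢0 = ⊥-elim (≢0 refl)
countB≢0⇒∃ p (x ∷ xs) ≢0 with p x in px
... | true  = x , px
... | false = countB≢0⇒∃ p xs ≢0

countB-++ : ∀ (p : A → Bool) xs ys → countB p (xs ++ ys) ≡ countB p xs + countB p ys
countB-++ p []       ys = refl
countB-++ p (x ∷ xs) ys = begin
  countB p (x ∷ xs ++ ys)                        ≡⟨ countB-∷ p x (xs ++ ys) ⟩
  indicator (p x) + countB p (xs ++ ys)          ≡⟨ cong (indicator (p x) +_) (countB-++ p xs ys) ⟩
  indicator (p x) + (countB p xs + countB p ys)  ≡⟨ +-assoc (indicator (p x)) _ _ ⟨
  indicator (p x) + countB p xs + countB p ys    ≡⟨ cong (_+ countB p ys) (countB-∷ p x xs) ⟨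
  countB p (x ∷ xs) + countB p ys                ∎
  where open ≡-Reasoning

countB-map : ∀ (p : B → Bool) (f : A → B) xs → countB p (map f xs) ≡ countB (p ∘ f) xs
countB-map p f []       = refl
countB-map p f (x ∷ xs) = begin
  countB p (f x ∷ map f xs)                  ≡⟨ countB-∷ p (f x) (map f xs) ⟩
  indicator (p (f x)) + countB p (map f xs)  ≡⟨ cong (indicator (p (f x)) +_) (countB-map p f xs) ⟩
  indicator (p (f x)) + countB (p ∘ f) xs    ≡⟨ countB-∷ (p ∘ f) x xs ⟨
  countB (p ∘ f) (x ∷ xs)                    ∎
  where open ≡-Reasoning

countB-concatMap : ∀ (p : B → Bool) (g : A → List B) xs →
  countB p (concatMap g xs) ≡ sum (map (countB p ∘ g) xs)
countB-concatMap p g []       = refl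
countB-concatMap p g (x ∷ xs) =
  trans (countB-++ p (g x) (concatMap g xs)) (cong (countB p (g x) +_) (countB-concatMap p g xs))

sum-indicator : ∀ (p : A → Bool) xs → sum (map (indicator ∘ p) xs) ≡ countB p xs
sum-indicator p []       = refl
sum-indicator p (x ∷ xs) = trans (cong (indicator (p x) +_) (sum-indicator p xs)) (sym (countB-∷ p x xs))

sum-map-zero : ∀ (xs : List A) → sum (map (λ _ → 0) xs) ≡ 0
sum-map-zero []       = refl
sum-map-zero (x ∷ xs) = sum-map-zero xs

sum-map-+ : ∀ (f g : A → ℕ) xs → sum (map (λ x → f x + g x) xs) ≡ sum (map f xs) + sum (map g xs)
sum-map-+ f g []       = refl
sum-map-+ f g (x ∷ xs) = trans (cong (f x + g x +_) (sum-map-+ f g xs))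
  (interchange +-commutativeSemigroup (f x) (g x) (sum (map f xs)) (sum (map g xs)))

sum-countB-swap : ∀ (R : A → B → Bool) xs ys →
  sum (map (λ x → countB (R x) ys) xs) ≡ sum (map (λ y → countB (λ x → R x y) xs) ys)
sum-countB-swap R []       ys = sym (sum-map-zero ys)
sum-countB-swap R (x ∷ xs) ys = begin
  countB (R x) ys + sum (map (λ x → countB (R x) ys) xs)
    ≡⟨ cong₂ _+_ (sym (sum-indicator (R x) ys)) (sum-countB-swap R xs ys) ⟩
  sum (map (indicator ∘ R x) ys) + sum (map (λ y → countB (λ x → R x y) xs) ys)
    ≡⟨ sum-map-+ (indicator ∘ R x) _ ys ⟨
  sum (map (λ y → indicator (R x y) + countB (λ x → R x y) xs) ys)
    ≡⟨ cong sum (map-cong (λ y → sym (countB-∷ (λ x → R x y) x xs)) ys) ⟩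
  sum (map (λ y → countB (λ x → R x y) (x ∷ xs)) ys)
    ∎
  where open ≡-Reasoning

countB-fibres : ∀ (P : A → Bool) (E : A → B → Bool) xs ys →
  (∀ x → P x ≡ true → countB (E x) ys ≡ 1) →
  countB P xs ≡ sum (map (λ y → countB (λ x → P x ∧ E x y) xs) ys)
countB-fibres P E xs ys unique = begin
  countB P xs
    ≡⟨ sum-indicator P xs ⟨
  sum (map (indicator ∘ P) xs)
    ≡⟨ cong sum (map-cong fibre-size xs) ⟩
  sum (map (λ x → countB (λ y → P x ∧ E x y) ys) xs)
    ≡⟨ sum-countB-swap (λ x y → P x ∧ E x y) xs ys ⟩
  sum (map (λ y → countB (λ x → P x ∧ E x y) xs) ys)
    ∎
  where
  open ≡-Reasoning
  fibre-size : ∀ x → indicator (P x) ≡ countB (λ y → P x ∧ E x y) ys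
  fibre-size x with P x in Px
  ... | true  = sym (unique x Px)
  ... | false = sym (countB-none ys (λ _ → refl))

countB-≟-unique : ∀ {n} {xs : List (Fin n)} {y} → Unique xs → y ∈ xs →
  countB (λ x → ⌊ x ≟ y ⌋) xs ≡ 1
countB-≟-unique {xs = y ∷ xs} {y} (y∉xs ∷ _) (here refl) =
  trans (countB-∷ (λ x → ⌊ x ≟ y ⌋) y xs)
        (cong₂ _+_ (cong indicator (⌊⌋-true⇔ (y ≟ y) .from refl))
               (countB-none xs (λ {x} x∈xs → ⌊⌋-false (x ≟ y) (All.lookup y∉xs x∈xs ∘ sym))))
countB-≟-unique {xs = x ∷ xs} {y} (x∉xs ∷ unique) (there y∈xs) =
  trans (countB-∷ (λ x → ⌊ x ≟ y ⌋) x xs)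
        (cong₂ _+_ (cong indicator (⌊⌋-false (x ≟ y) (All.lookup x∉xs y∈xs)))
               (countB-≟-unique unique y∈xs))

infix 4 _≗ᵇ_

_≗ᵇ_ : ∀ {a b} → (Fin a → Fin b) → (Fin a → Fin b) → Bool
_≗ᵇ_ {a} f g = allB a (λ i → ⌊ f i ≟ g i ⌋)

≗ᵇ⇔ : ∀ {a b} {f g : Fin a → Fin b} → (f ≗ᵇ g) ≡ true ⇔ f ≗ g
≗ᵇ⇔ {f = f} {g} = mk⇔
  (λ e i → ⌊⌋-true⇔ (f i ≟ g i) .to (allB-true⇔ .to e i))
  (λ f≗g → allB-true⇔ .from (λ i → ⌊⌋-true⇔ (f i ≟ g i) .from (f≗g i)))

≗ᵇ-cons : ∀ {a b} x (f : Fin a → Fin b) (h g : Fin (suc a) → Fin b) →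
  h zero ≡ x → (∀ i → h (suc i) ≡ f i) →
  (h ≗ᵇ g) ≡ (⌊ x ≟ g zero ⌋ ∧ (f ≗ᵇ g ∘ suc))
≗ᵇ-cons x f h g h0 hsuc = ≡true-ext
  (λ e → let h≗g = ≗ᵇ⇔ .to e in ∧-true⁺
    (⌊⌋-true⇔ (x ≟ g zero) .from (trans (sym h0) (h≗g zero)))
    (≗ᵇ⇔ .from (λ i → trans (sym (hsuc i)) (h≗g (suc i)))))
  (λ e → let x≡g0 , f≗g∘suc = ∧-true⁻ e in ≗ᵇ⇔ .from λ where
    zero    → trans h0 (⌊⌋-true⇔ (x ≟ g zero) .to x≡g0)
    (suc i) → trans (hsuc i) (≗ᵇ⇔ .to f≗g∘suc i))

funs-unique : ∀ a b (g : Fin a → Fin b) → countB (_≗ᵇ g) (funs a b) ≡ 1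
funs-unique zero    b g = refl
funs-unique (suc a) b g = begin
  countB (_≗ᵇ g) (funs (suc a) b)
    ≡⟨ countB-concatMap (_≗ᵇ g) _ (allFin b) ⟩
  sum (map (λ x → countB (_≗ᵇ g) (map _ (funs a b))) (allFin b))
    ≡⟨ cong sum (map-cong extensions-of-g (allFin b)) ⟩
  sum (map (indicator ∘ (λ x → ⌊ x ≟ g zero ⌋)) (allFin b))
    ≡⟨ sum-indicator (λ x → ⌊ x ≟ g zero ⌋) (allFin b) ⟩
  countB (λ x → ⌊ x ≟ g zero ⌋) (allFin b)
    ≡⟨ countB-≟-unique (Unique.allFin⁺ b) (∈-allFin (g zero)) ⟩
  1 ∎
  where
  open ≡-Reasoning
  -- The holes stand for the function cons local to funs, recovered by unification.
  extensions-of-g : ∀ x → countB (_≗ᵇ g) (map _ (funs a b)) ≡ indicator ⌊ x ≟ g zero ⌋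
  extensions-of-g x = begin
    countB (_≗ᵇ g) (map _ (funs a b))
      ≡⟨ countB-map (_≗ᵇ g) _ (funs a b) ⟩
    countB (λ f → _ ≗ᵇ g) (funs a b)
      ≡⟨ countB-cong (λ f → ≗ᵇ-cons x f _ g refl (λ _ → refl)) (funs a b) ⟩
    countB (λ f → ⌊ x ≟ g zero ⌋ ∧ (f ≗ᵇ g ∘ suc)) (funs a b)
      ≡⟨ head-matches ⌊ x ≟ g zero ⌋ ⟩
    indicator ⌊ x ≟ g zero ⌋ ∎
    where
    head-matches : ∀ c → countB (λ f → c ∧ (f ≗ᵇ g ∘ suc)) (funs a b) ≡ indicator c
    head-matches true  = funs-unique a b (g ∘ suc)
    head-matches false = countB-none (funs a b) (λ _ → refl)

Respects≗ : ∀ {a m} → ((Fin a → Fin m) → Bool) → Set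
Respects≗ P = ∀ {f f'} → f ≗ f' → P f ≡ P f'

record ≗-Bijection {a c m} (P : (Fin a → Fin m) → Bool) (Q : (Fin c → Fin m) → Bool) : Set where
  field
    to        : (Fin a → Fin m) → (Fin c → Fin m)
    from      : (Fin c → Fin m) → (Fin a → Fin m)
    to-cong   : ∀ {f f'} → f ≗ f' → to f ≗ to f'
    from-cong : ∀ {g g'} → g ≗ g' → from g ≗ from g'
    to-∈      : ∀ {f} → P f ≡ true → Q (to f) ≡ true
    from-∈    : ∀ {g} → Q g ≡ true → P (from g) ≡ true
    from∘to   : ∀ {f} → P f ≡ true → from (to f) ≗ f
    to∘from   : ∀ {g} → Q g ≡ true → to (from g) ≗ g

countB-funs-bijection : ∀ {a c m} {P : (Fin a → Fin m) → Bool} {Q : (Fin c → Fin m) → Bool} →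
  Respects≗ P → Respects≗ Q → ≗-Bijection P Q → countB P (funs a m) ≡ countB Q (funs c m)
countB-funs-bijection {a} {c} {m} {P} {Q} P-cong Q-cong bij = begin
  countB P (funs a m)
    ≡⟨ countB-fibres P (λ f g → g ≗ᵇ B.to f) (funs a m) (funs c m)
         (λ f _ → funs-unique c m (B.to f)) ⟩
  sum (map (λ g → countB (λ f → P f ∧ (g ≗ᵇ B.to f)) (funs a m)) (funs c m))
    ≡⟨ cong sum (map-cong fibre-size (funs c m)) ⟩
  sum (map (indicator ∘ Q) (funs c m))
    ≡⟨ sum-indicator Q (funs c m) ⟩
  countB Q (funs c m) ∎
  where
  open ≡-Reasoning
  module B = ≗-Bijection bij
  fibre-size : ∀ g → countB (λ f → P f ∧ (g ≗ᵇ B.to f)) (funs a m) ≡ indicator (Q g)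
  fibre-size g with Q g in Qg
  ... | true = trans (countB-cong fibre≡from-g (funs a m)) (funs-unique a m (B.from g))
    where
    fibre≡from-g : ∀ f → (P f ∧ (g ≗ᵇ B.to f)) ≡ (f ≗ᵇ B.from g)
    fibre≡from-g f = ≡true-ext
      (λ e → let Pf , g≗to-f = ∧-true⁻ e in ≗ᵇ⇔ .from λ x →
        trans (sym (B.from∘to Pf x)) (B.from-cong (λ y → sym (≗ᵇ⇔ .to g≗to-f y)) x))
      (λ e → let f≗from-g = ≗ᵇ⇔ .to e in ∧-true⁺
        (trans (P-cong f≗from-g) (B.from-∈ Qg))
        (≗ᵇ⇔ .from λ y → trans (sym (B.to∘from Qg y)) (B.to-cong (λ x → sym (f≗from-g x)) y)))
  ... | false = countB-none (funs a m) λ {f} _ → ≡true-ext {b = false}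
    (λ e → let Pf , g≗to-f = ∧-true⁻ e in
      trans (sym Qg) (trans (Q-cong (≗ᵇ⇔ .to g≗to-f)) (B.to-∈ Pf)))
    (λ ())

-- Trees

module _ {n} {le : Rel n} (tree : IsTree le) where
  open IsTree tree

  IsLeast : (Fin n → Bool) → Fin n → Set
  IsLeast S m = S m ≡ true × (∀ y → S y ≡ true → le m y ≡ true)

  least-unique : ∀ {S m m'} → IsLeast S m → IsLeast S m' → m ≡ m'
  least-unique (Sm , m≤) (Sm' , m'≤) = antisym _ _ (m≤ _ Sm') (m'≤ _ Sm)

  ≰⇒≥-below : ∀ {v x y} → le x v ≡ true → le y v ≡ true → le x y ≡ false → le y x ≡ true
  ≰⇒≥-below {v} {x} {y} x≤v y≤v x≰y with downChain v x y x≤v y≤v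
  ... | inj₁ x≤y = ⊥-elim (≡true⇒≢false x≤y x≰y)
  ... | inj₂ y≤x = y≤x

  -- A set of ancestors of v is a chain, so a single scan finds its least element.
  least-ancestor : ∀ (S : Fin n → Bool) v → S v ≡ true → (∀ u → S u ≡ true → le u v ≡ true) →
    Σ (Fin n) (IsLeast S)
  least-ancestor S v Sv S⊆↓v =
    let m , Sm , m≤ = scan (allFin n) in m , Sm , λ y Sy → m≤ (∈-allFin y) Sy
    where
    scan : ∀ xs →
      Σ (Fin n) λ m → S m ≡ true × (∀ {y} → y ∈ xs → S y ≡ true → le m y ≡ true)
    scan []       = v , Sv , λ ()
    scan (x ∷ xs) with scan xs | S x in Sx
    ... | m , Sm , m≤ | false = m , Sm , λ where
      (here refl) Sy → ⊥-elim (≡true⇒≢false Sy Sx)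
      (there y∈xs) → m≤ y∈xs
    ... | m , Sm , m≤ | true with le x m in x≤m
    ...   | true  = x , Sx , λ where
      (here refl) _ → reflexive x
      (there y∈xs) Sy → transitive x m _ x≤m (m≤ y∈xs Sy)
    ...   | false = m , Sm , λ where
      (here refl) _ → ≰⇒≥-below (S⊆↓v x Sx) (S⊆↓v m Sm) x≤m
      (there y∈xs) → m≤ y∈xs

  IsLeast-cong : ∀ {S S' m} → (∀ u → S u ≡ S' u) → IsLeast S m → IsLeast S' m
  IsLeast-cong {m = m} S≗S' (Sm , m≤) = trans (sym (S≗S' m)) Sm , λ y S'y → m≤ y (trans (S≗S' y) S'y)

  root : Fin n
  root = proj₁ uniqueMin

  root-least : ∀ v → le root v ≡ true
  root-least v with least-ancestor (λ u → le u v) v (reflexive v) (λ _ u≤v → u≤v)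
  ... | m , m≤v , m≤ = subst (λ r → le r v ≡ true) (proj₂ (proj₂ uniqueMin) m m-minimal) m≤v
    where
    m-minimal : Minimal le m
    m-minimal w w≤m = antisym w m w≤m (m≤ w (transitive w m v w≤m m≤v))

  module _ {m} (h : Fin n → Fin m) where

    sameImageAncestor : Fin n → Fin n → Bool
    sameImageAncestor v u = le u v ∧ ⌊ h u ≟ h v ⌋

    private
      least-twin : ∀ v → Σ (Fin n) (IsLeast (sameImageAncestor v))
      least-twin v = least-ancestor (sameImageAncestor v) v
        (∧-true⁺ (reflexive v) (⌊⌋-true⇔ (h v ≟ h v) .from refl)) (λ _ → proj₁ ∘ ∧-true⁻)

    earliest : Fin n → Fin n
    earliest v = proj₁ (least-twin v)

    earliest-least : ∀ v → IsLeast (sameImageAncestor v) (earliest v)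
    earliest-least v = proj₂ (least-twin v)

    earliest-≤ : ∀ v → le (earliest v) v ≡ true
    earliest-≤ v = proj₁ (∧-true⁻ (proj₁ (earliest-least v)))

    earliest-image : ∀ v → h (earliest v) ≡ h v
    earliest-image v =
      ⌊⌋-true⇔ (h (earliest v) ≟ h v) .to (proj₂ (∧-true⁻ (proj₁ (earliest-least v))))

    ≗earliest⇒same-image : ∀ {r} → r ≗ earliest → ∀ v → h (r v) ≡ h v
    ≗earliest⇒same-image r≗earliest v = trans (cong h (r≗earliest v)) (earliest-image v)

    earliest-≤-twin : ∀ {u v} → le u v ≡ true → h u ≡ h v → le (earliest v) u ≡ true
    earliest-≤-twin {u} {v} u≤v hu≡hv =
      proj₂ (earliest-least v) u (∧-true⁺ u≤v (⌊⌋-true⇔ (h u ≟ h v) .from hu≡hv))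

  earliest-≗ : ∀ {m} {h h' : Fin n → Fin m} → h ≗ h' → earliest h ≗ earliest h'
  earliest-≗ {h = h} {h'} h≗h' v =
    least-unique (IsLeast-cong same-twins (earliest-least h v)) (earliest-least h' v)
    where
    same-twins : ∀ u → sameImageAncestor h v u ≡ sameImageAncestor h' v u
    same-twins u = cong (le u v ∧_) (cong₂ (λ x y → ⌊ x ≟ y ⌋) (h≗h' u) (h≗h' v))

  IsTree-pull : ∀ {c} {ι : Fin c → Fin n} → Injective _≡_ _≡_ ι →
    ∀ i₀ → ι i₀ ≡ root → IsTree (pull le ι)
  IsTree-pull {ι = ι} ι-inj i₀ ιi₀≡root = record
    { reflexive  = λ u → reflexive (ι u)
    ; antisym    = λ u v u≤v v≤u → ι-inj (antisym (ι u) (ι v) u≤v v≤u)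
    ; transitive = λ u v w → transitive (ι u) (ι v) (ι w)
    ; uniqueMin  = i₀ , i₀-minimal , λ r' r'-minimal → sym (r'-minimal i₀ (i₀≤ r'))
    ; downChain  = λ t u v → downChain (ι t) (ι u) (ι v)
    }
    where
    i₀≤ : ∀ u → pull le ι i₀ u ≡ true
    i₀≤ u = subst (λ x → le x (ι u) ≡ true) (sym ιi₀≡root) (root-least (ι u))
    i₀-minimal : Minimal (pull le ι) i₀
    i₀-minimal u u≤i₀ = ι-inj (trans (root-minimal (ι u) u≤root) (sym ιi₀≡root))
      where
      root-minimal = proj₁ (proj₂ uniqueMin)
      u≤root = subst (λ x → le (ι u) x ≡ true) ιi₀≡root u≤i₀

HeightAtMost-pull : ∀ {n c k} {le : Rel n} {ι : Fin c → Fin n} → Injective _≡_ _≡_ ι →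
  HeightAtMost k le → HeightAtMost k (pull le ι)
HeightAtMost-pull {k = k} {ι = ι} ι-inj height chain unique comparable =
  subst (_≤ k) (length-map ι chain)
    (height (map ι chain) (Unique.map⁺ ι-inj unique) (AllPairs.map⁺ comparable))

-- Enumerating a decidable subset of Fin n

record Enumeration {n} (P : Fin n → Bool) : Set where
  field
    card            : ℕ
    embed           : Fin card → Fin n
    embed-injective : Injective _≡_ _≡_ embed
    embed-∈         : ∀ i → P (embed i) ≡ true
    index           : ∀ v → P v ≡ true → Fin card
    embed-index     : ∀ v Pv → embed (index v Pv) ≡ v

module _ {n} {P : Fin (suc n) → Bool} (E : Enumeration (P ∘ suc)) where
  open Enumeration E

  enumeration-keep : P zero ≡ true → Enumeration P
  enumeration-keep P0 = record
    { card = suc card ; embed = embed′ ; embed-injective = injective ; embed-∈ = embed′-∈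
    ; index = index′ ; embed-index = embed-index′ }
    where
    embed′ : Fin (suc card) → Fin (suc n)
    embed′ zero    = zero
    embed′ (suc i) = suc (embed i)
    injective : Injective _≡_ _≡_ embed′
    injective {zero}  {zero}  _ = refl
    injective {suc i} {suc j} e = cong suc (embed-injective (suc-injective e))
    embed′-∈ : ∀ i → P (embed′ i) ≡ true
    embed′-∈ zero    = P0
    embed′-∈ (suc i) = embed-∈ i
    index′ : ∀ v → P v ≡ true → Fin (suc card)
    index′ zero    _  = zero
    index′ (suc v) Pv = suc (index v Pv)
    embed-index′ : ∀ v Pv → embed′ (index′ v Pv) ≡ v
    embed-index′ zero    _  = refl
    embed-index′ (suc v) Pv = cong suc (embed-index v Pv)

  enumeration-skip : P zero ≡ false → Enumeration P
  enumeration-skip ¬P0 = record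
    { card = card ; embed = suc ∘ embed ; embed-injective = embed-injective ∘ suc-injective
    ; embed-∈ = embed-∈ ; index = index′ ; embed-index = embed-index′ }
    where
    index′ : ∀ v → P v ≡ true → Fin card
    index′ zero    P0 = ⊥-elim (≡true⇒≢false P0 ¬P0)
    index′ (suc v) Pv = index v Pv
    embed-index′ : ∀ v Pv → suc (embed (index′ v Pv)) ≡ v
    embed-index′ zero    P0 = ⊥-elim (≡true⇒≢false P0 ¬P0)
    embed-index′ (suc v) Pv = cong suc (embed-index v Pv)

enumerate : ∀ {n} (P : Fin n → Bool) → Enumeration P
enumerate {zero}  P = record
  { card = 0 ; embed = λ () ; embed-injective = λ { {()} }
  ; embed-∈ = λ () ; index = λ () ; embed-index = λ () }
enumerate {suc n} P with P zero in P0
... | true  = enumeration-keep (enumerate (P ∘ suc)) P0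
... | false = enumeration-skip (enumerate (P ∘ suc)) P0

-- Contraction along an elimination tree

module _ (F : Graph) (T : Rel (size F)) (tree : IsTree T) where
  open IsTree tree

  private
    n = size F

  record IsAncestorContraction (r : Fin n → Fin n) : Set where
    field
      contract-≤    : ∀ v → T (r v) v ≡ true
      contract-idem : ∀ v → r (r v) ≡ r v
      contract-edge : ∀ u v → adj F u v ≡ true → r u ≢ r v
      contract-col  : ∀ v → col F (r v) ≡ col F v

  earliest-contraction : ∀ {K} {h : Fin n → Fin (size K)} {r} →
    IsHom F K h → r ≗ earliest tree h → IsAncestorContraction r
  earliest-contraction {K} {h} {r} h-hom r≗earliest = record
    { contract-≤    = r-≤
    ; contract-idem = λ v → antisym _ _ (r-≤ (r v))
        (r-≤-twin (transitive _ _ v (r-≤ (r v)) (r-≤ v)) (trans (r-image (r v)) (r-image v)))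
    ; contract-edge = λ u v uv ru≡rv → ≡true⇒≢false
        (subst (λ x → adj K (h u) x ≡ true) (sym (same-image ru≡rv)) (IsHom.adj-pres h-hom u v uv))
        (Graph.irrefl K (h u))
    ; contract-col  = λ v → trans (sym (IsHom.col-pres h-hom (r v)))
        (trans (cong (col K) (r-image v)) (IsHom.col-pres h-hom v))
    }
    where
    r-≤ : ∀ v → T (r v) v ≡ true
    r-≤ v = subst (λ x → T x v ≡ true) (sym (r≗earliest v)) (earliest-≤ tree h v)
    r-image : ∀ v → h (r v) ≡ h v
    r-image = ≗earliest⇒same-image tree h r≗earliest
    r-≤-twin : ∀ {u v} → T u v ≡ true → h u ≡ h v → T (r v) u ≡ true
    r-≤-twin {u} {v} u≤v hu≡hv =
      subst (λ x → T x u ≡ true) (sym (r≗earliest v)) (earliest-≤-twin tree h u≤v hu≡hv)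
    same-image : ∀ {u v} → r u ≡ r v → h u ≡ h v
    same-image {u} {v} ru≡rv = trans (sym (r-image u)) (trans (cong h ru≡rv) (r-image v))

  isHomWithEarliest : (K : Graph) → (Fin n → Fin n) → (Fin n → Fin (size K)) → Bool
  isHomWithEarliest K r h = isHom F K h ∧ (r ≗ᵇ earliest tree h)

  module Quotient {r : Fin n → Fin n} (contraction : IsAncestorContraction r) where
    open IsAncestorContraction contraction
    open Enumeration (enumerate (λ v → ⌊ r v ≟ v ⌋)) public

    r-embed : ∀ i → r (embed i) ≡ embed i
    r-embed i = ⌊⌋-true⇔ (r (embed i) ≟ embed i) .to (embed-∈ i)

    class : Fin n → Fin card
    class v = index (r v) (⌊⌋-true⇔ (r (r v) ≟ r v) .from (contract-idem v))

    embed-class : ∀ v → embed (class v) ≡ r v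
    embed-class v = embed-index (r v) _

    class-embed : ∀ i → class (embed i) ≡ i
    class-embed i = embed-injective (trans (embed-class (embed i)) (r-embed i))

    class-r : ∀ v → class (r v) ≡ class v
    class-r v = embed-injective (trans (embed-class (r v)) (trans (contract-idem v) (sym (embed-class v))))

    Edge : Fin card → Fin card → Set
    Edge i j = ∃₂ λ u v → adj F u v ≡ true × r u ≡ embed i × r v ≡ embed j

    edge? : ∀ i j → Dec (Edge i j)
    edge? i j = any? λ u → any? λ v →
      (adj F u v ≟ᵇ true) ×-dec (r u ≟ embed i) ×-dec (r v ≟ embed j)

    Edge-sym : ∀ {i j} → Edge i j → Edge j i
    Edge-sym (u , v , uv , ru , rv) = v , u , trans (Graph.sym F v u) uv , rv , ru

    Edge-irrefl : ∀ {i} → ¬ Edge i i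
    Edge-irrefl (u , v , uv , ru , rv) = contract-edge u v uv (trans ru (sym rv))

    quotient : Graph
    quotient = record
      { size   = card
      ; adj    = λ i j → ⌊ edge? i j ⌋
      ; sym    = λ i j → ≡true-ext
                   (λ e → ⌊⌋-true⇔ (edge? j i) .from (Edge-sym (⌊⌋-true⇔ (edge? i j) .to e)))
                   (λ e → ⌊⌋-true⇔ (edge? i j) .from (Edge-sym (⌊⌋-true⇔ (edge? j i) .to e)))
      ; irrefl = λ i → ⌊⌋-false (edge? i i) Edge-irrefl
      ; col    = col F ∘ embed
      }

    contract-comparable : ∀ {u v} → Comparable T u v → Comparable T (r u) (r v)
    contract-comparable {u} {v} (inj₁ u≤v) =
      downChain v (r u) (r v) (transitive (r u) u v (contract-≤ u) u≤v) (contract-≤ v)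
    contract-comparable {u} {v} (inj₂ v≤u) =
      downChain u (r u) (r v) (contract-≤ u) (transitive (r v) v u (contract-≤ v) v≤u)

    quotient-InD : ∀ {k} → InD k F T → InD k quotient (pull T embed)
    quotient-InD (_ , elim , height) =
      IsTree-pull tree embed-injective (class (root tree)) embed-class-root ,
      edge-comparable ,
      HeightAtMost-pull embed-injective height
      where
      embed-class-root : embed (class (root tree)) ≡ root tree
      embed-class-root = trans (embed-class _) (antisym _ _ (contract-≤ (root tree)) (root-least tree _))
      edge-comparable : IsElimTree quotient (pull T embed)
      edge-comparable i j ij with ⌊⌋-true⇔ (edge? i j) .to ij
      ... | u , v , uv , ru , rv = subst₂ (Comparable T) ru rv (contract-comparable (elim u v uv))

    module _ (K : Graph) where

      hom-to-quotient : ∀ {h : Fin n → Fin (size K)} → IsHom F K h → r ≗ earliest tree h →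
        IsHom quotient K (h ∘ embed) × PastInjective quotient K (pull T embed) (h ∘ embed)
      hom-to-quotient {h} h-hom r≗earliest =
        isHomomorphism (λ i → IsHom.col-pres h-hom (embed i)) edge-pres , past-injective
        where
        r-image : ∀ v → h (r v) ≡ h v
        r-image = ≗earliest⇒same-image tree h r≗earliest
        edge-pres : ∀ i j → ⌊ edge? i j ⌋ ≡ true → adj K (h (embed i)) (h (embed j)) ≡ true
        edge-pres i j ij with ⌊⌋-true⇔ (edge? i j) .to ij
        ... | u , v , uv , ru , rv = subst₂ (λ x y → adj K x y ≡ true)
          (trans (sym (r-image u)) (cong h ru)) (trans (sym (r-image v)) (cong h rv))
          (IsHom.adj-pres h-hom u v uv)
        -- embed j is the earliest vertex with its image, so no proper ancestor shares that image.
        past-injective : PastInjective quotient K (pull T embed) (h ∘ embed)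
        past-injective i j i≤j i≢j hi≡hj = i≢j (embed-injective (antisym _ _ i≤j j≤i))
          where
          j≤i : T (embed j) (embed i) ≡ true
          j≤i = subst (λ x → T x (embed i) ≡ true) (trans (sym (r≗earliest (embed j))) (r-embed j))
                  (earliest-≤-twin tree h i≤j hi≡hj)

      hom-from-quotient : ∀ {g : Fin card → Fin (size K)} →
        IsHom quotient K g → PastInjective quotient K (pull T embed) g →
        IsHom F K (g ∘ class) × r ≗ earliest tree (g ∘ class)
      hom-from-quotient {g} g-hom g-pinj = isHomomorphism col-pres adj-pres , r≗earliest
        where
        col-pres : ∀ v → col K (g (class v)) ≡ col F v
        col-pres v = trans (IsHom.col-pres g-hom (class v))
          (trans (cong (col F) (embed-class v)) (contract-col v))
        adj-pres : ∀ u v → adj F u v ≡ true → adj K (g (class u)) (g (class v)) ≡ true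
        adj-pres u v uv = IsHom.adj-pres g-hom (class u) (class v)
          (⌊⌋-true⇔ (edge? (class u) (class v)) .from
            (u , v , uv , sym (embed-class u) , sym (embed-class v)))
        -- The earliest twin w of v lies below r v; were it strictly below, r w and r v would be
        -- distinct comparable vertices of the quotient with the same image.
        r≗earliest : r ≗ earliest tree (g ∘ class)
        r≗earliest v = antisym (r v) w rv≤w w≤rv
          where
          w = earliest tree (g ∘ class) v
          w≤rv : T w (r v) ≡ true
          w≤rv = earliest-≤-twin tree (g ∘ class) (contract-≤ v) (cong g (class-r v))
          rv≤w : T (r v) w ≡ true
          rv≤w with class w ≟ class v
          ... | yes same = subst (λ x → T x w ≡ true)
                  (trans (sym (embed-class w)) (trans (cong embed same) (embed-class v))) (contract-≤ w)
          ... | no  diff = ⊥-elim (g-pinj (class w) (class v)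
                  (subst₂ (λ x y → T x y ≡ true) (sym (embed-class w)) (sym (embed-class v))
                    (transitive (r w) w (r v) (contract-≤ w) w≤rv))
                  diff (earliest-image tree (g ∘ class) v))

      isHomWithEarliest-count :
        countB (isHomWithEarliest K r) (funs n (size K)) ≡ piHom quotient (pull T embed) K
      isHomWithEarliest-count = countB-funs-bijection P-cong Q-cong record
        { to        = _∘ embed
        ; from      = _∘ class
        ; to-cong   = λ f≗f' → f≗f' ∘ embed
        ; from-cong = λ g≗g' → g≗g' ∘ class
        ; to-∈      = λ {h} e →
            let h-hom , r≗earliest = ∧-true⁻ e
                q-hom , q-pinj = hom-to-quotient (isHom⇔ F K h .to h-hom) (≗ᵇ⇔ .to r≗earliest)
            in ∧-true⁺ (isHom⇔ quotient K _ .from q-hom) (isPastInj⇔ quotient K _ _ .from q-pinj)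
        ; from-∈    = λ {g} e →
            let g-hom , g-pinj = ∧-true⁻ e
                h-hom , r≗earliest = hom-from-quotient (isHom⇔ quotient K g .to g-hom)
                                       (isPastInj⇔ quotient K _ g .to g-pinj)
            in ∧-true⁺ (isHom⇔ F K _ .from h-hom) (≗ᵇ⇔ .from r≗earliest)
        ; from∘to   = λ {h} e v → trans (cong h (embed-class v))
                        (≗earliest⇒same-image tree h (≗ᵇ⇔ .to (proj₂ (∧-true⁻ e))) v)
        ; to∘from   = λ {g} _ i → cong g (class-embed i)
        }
        where
        P-cong : Respects≗ (isHomWithEarliest K r)
        P-cong h≗h' = cong₂ _∧_ (isHom-≗ F K h≗h') (≡true-ext
          (λ e → ≗ᵇ⇔ .from λ v → trans (≗ᵇ⇔ .to e v) (earliest-≗ tree h≗h' v))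
          (λ e → ≗ᵇ⇔ .from λ v → trans (≗ᵇ⇔ .to e v) (sym (earliest-≗ tree h≗h' v))))
        Q-cong : Respects≗ (λ g → isHom quotient K g ∧ isPastInj quotient K (pull T embed) g)
        Q-cong g≗g' = cong₂ _∧_ (isHom-≗ quotient K g≗g') (isPastInj-≗ quotient K _ g≗g')

  hom-by-earliest : ∀ K →
    hom F K ≡ sum (map (λ r → countB (isHomWithEarliest K r) (funs n (size K))) (funs n n))
  hom-by-earliest K =
    countB-fibres (isHom F K) (λ h r → r ≗ᵇ earliest tree h) (funs n (size K)) (funs n n)
      (λ h _ → funs-unique n n (earliest tree h))

corollary9 : (k : ℕ) (F : Graph) (T : Rel (size F)) → InD k F T →
    (H H' : Graph) →
    ((G : Graph) (ι : Fin (size G) → Fin (size F)) → Injective _≡_ _≡_ ι →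
      (∀ v → col G v ≡ col F (ι v)) →
      InD k G (pull T ι) →
      piHom G (pull T ι) H ≡ piHom G (pull T ι) H') →
    hom F H ≡ hom F H'
corollary9 k F T D@(tree , _) H H' piHom-agree = begin
  hom F H                                  ≡⟨ hom-by-earliest F T tree H ⟩
  sum (map (fibre H) (funs n n))           ≡⟨ cong sum (map-cong fibres-agree (funs n n)) ⟩
  sum (map (fibre H') (funs n n))          ≡⟨ hom-by-earliest F T tree H' ⟨
  hom F H'                                 ∎
  where
  open ≡-Reasoning
  n = size F
  fibre : Graph → (Fin n → Fin n) → ℕ
  fibre K r = countB (isHomWithEarliest F T tree K r) (funs n (size K))
  -- A nonempty fibre makes r a contraction, whose quotient is a subgraph the hypothesis applies to.
  fibres-agree-if-inhabited : ∀ K r → fibre K r ≢ 0 → fibre H r ≡ fibre H' r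
  fibres-agree-if-inhabited K r nonempty with countB≢0⇒∃ _ (funs n (size K)) nonempty
  ... | h , e = let h-hom , r≗earliest = ∧-true⁻ e
                    contraction = earliest-contraction F T tree
                                    (isHom⇔ F K h .to h-hom) (≗ᵇ⇔ .to r≗earliest)
                    module Q = Quotient F T tree contraction
                in begin
    fibre H r                             ≡⟨ Q.isHomWithEarliest-count H ⟩
    piHom Q.quotient (pull T Q.embed) H   ≡⟨ piHom-agree Q.quotient Q.embed Q.embed-injective
                                               (λ _ → refl) (Q.quotient-InD D) ⟩
    piHom Q.quotient (pull T Q.embed) H'  ≡⟨ Q.isHomWithEarliest-count H' ⟨
    fibre H' r                            ∎
  fibres-agree : ∀ r → fibre H r ≡ fibre H' r
  fibres-agree r with fibre H r ℕ.≟ 0 | fibre H' r ℕ.≟ 0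
  ... | yes empty | yes empty' = trans empty (sym empty')
  ... | no nonempty | _ = fibres-agree-if-inhabited H r nonempty
  ... | _ | no nonempty = fibres-agree-if-inhabited H' r nonempty
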